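{- In a category of worlds all morphisms are monomorphisms, and if $xu=x'u'$ with $x:w\to\overline{w}$, $x':w'\to\overline{w}$, $u:\underline{w}\to w$, $u':\underline{w}\to w'$ is a minimal pullback square with apex $\overline{w}$, then $x$ and $x'$ are jointly epic: for any $f,g:\overline{w}\to w_1$, if $fx=gx$ and $fx'=gx'$ then $f=g$.
   Context: A commuting square $xu=x'u'$ is a pullback if whenever $xv=x'v'$ there is a unique $t$ with $v=ut$ and $v'=u't$. The common codomain $\overline{w}$ of $x,x'$ is the apex, the common domain $\underline{w}$ of $u,u'$ the low point. A pullback square with apex $\overline{w}$ over a span $u,u'$ is minimal if for any other pullback $x_1u=x_1'u'$ over the same span with apex $\overline{w_1}$ there is a unique $t:\overline{w}\to\overline{w_1}$ with $x_1=tx$, $x_1'=tx'$. A category of worlds is a category with pullbacks in which every span can be completed to a minimal pullback square, together with a poset subcategory of inclusions, full on objects, such that every morphism factors both as an inclusion followed by an isomorphism and as an isomorphism followed by an inclusion. -}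

module Defs where

open import Level using (Level; _⊔_; suc)
open import Relation.Binary.PropositionalEquality using (_≡_)
open import Data.Product using (Σ; _×_; _,_)

record Category (o ℓ : Level) : Set (suc (o ⊔ ℓ)) where
  infixr 9 _∘_
  field
    Obj  : Set o
    Hom  : Obj → Obj → Set ℓ
    id   : ∀ {a} → Hom a a
    _∘_  : ∀ {a b c} → Hom b c → Hom a b → Hom a c
    identityˡ : ∀ {a b} (f : Hom a b) → id ∘ f ≡ f
    identityʳ : ∀ {a b} (f : Hom a b) → f ∘ id ≡ f
    assoc : ∀ {a b c d} (h : Hom c d) (g : Hom b c) (f : Hom a b) →
            (h ∘ g) ∘ f ≡ h ∘ (g ∘ f)

module _ {o ℓ : Level} (C : Category o ℓ) where
  open Category C

  ∃! : ∀ {a} {A : Set a} {p} → (A → Set p) → Set (a ⊔ p)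
  ∃! {A = A} P = Σ A (λ t → P t × (∀ t' → P t' → t' ≡ t))

  Mono : ∀ {a b} → Hom a b → Set (o ⊔ ℓ)
  Mono {a} {b} f = ∀ {z} (g h : Hom z a) → f ∘ g ≡ f ∘ h → g ≡ h

  IsIso : ∀ {a b} → Hom a b → Set ℓ
  IsIso {a} {b} f = Σ (Hom b a) (λ g → (g ∘ f ≡ id) × (f ∘ g ≡ id))

  IsPullback : ∀ {w w' W̄ w̲} (x : Hom w W̄) (x' : Hom w' W̄)
               (u : Hom w̲ w) (u' : Hom w̲ w') → Set (o ⊔ ℓ)
  IsPullback {w} {w'} {W̄} {w̲} x x' u u' =
    (x ∘ u ≡ x' ∘ u') ×
    (∀ {z} (v : Hom z w) (v' : Hom z w') → x ∘ v ≡ x' ∘ v' →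
       ∃! (λ (t : Hom z w̲) → (v ≡ u ∘ t) × (v' ≡ u' ∘ t)))

  IsMinimalPullback : ∀ {w w' W̄ w̲} (x : Hom w W̄) (x' : Hom w' W̄)
                      (u : Hom w̲ w) (u' : Hom w̲ w') → Set (o ⊔ ℓ)
  IsMinimalPullback {w} {w'} {W̄} {w̲} x x' u u' =
    IsPullback x x' u u' ×
    (∀ {W̄₁} (x₁ : Hom w W̄₁) (x₁' : Hom w' W̄₁) → IsPullback x₁ x₁' u u' →
       ∃! (λ (t : Hom W̄ W̄₁) → (x₁ ≡ t ∘ x) × (x₁' ≡ t ∘ x')))

  HasPullbacks : Set (o ⊔ ℓ)
  HasPullbacks = ∀ {w w' W̄} (x : Hom w W̄) (x' : Hom w' W̄) →
    Σ Obj (λ w̲ → Σ (Hom w̲ w) (λ u → Σ (Hom w̲ w') (λ u' → IsPullback x x' u u')))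

  SpansHaveMinimalPullbacks : Set (o ⊔ ℓ)
  SpansHaveMinimalPullbacks = ∀ {w̲ w w'} (u : Hom w̲ w) (u' : Hom w̲ w') →
    Σ Obj (λ W̄ → Σ (Hom w W̄) (λ x → Σ (Hom w' W̄) (λ x' → IsMinimalPullback x x' u u')))

record CategoryOfWorlds (o ℓ i : Level) : Set (suc (o ⊔ ℓ ⊔ i)) where
  field
    cat : Category o ℓ
  open Category cat
  field
    pullbacks        : HasPullbacks cat
    minimalPullbacks : SpansHaveMinimalPullbacks cat
    -- poset subcategory of inclusions, full on objects (all objects belong to it)
    Incl      : ∀ {a b} → Hom a b → Set i
    incl-id   : ∀ {a} → Incl (id {a})
    incl-∘    : ∀ {a b c} {f : Hom b c} {g : Hom a b} → Incl f → Incl g → Incl (f ∘ g)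
    incl-thin : ∀ {a b} {f g : Hom a b} → Incl f → Incl g → f ≡ g
    incl-antisym : ∀ {a b} {f : Hom a b} {g : Hom b a} → Incl f → Incl g → a ≡ b
    factor-incl-iso : ∀ {a b} (f : Hom a b) →
      Σ Obj (λ c → Σ (Hom a c) (λ j → Σ (Hom c b) (λ s →
        Incl j × IsIso cat s × (f ≡ s ∘ j))))
    factor-iso-incl : ∀ {a b} (f : Hom a b) →
      Σ Obj (λ c → Σ (Hom a c) (λ s → Σ (Hom c b) (λ j →
        IsIso cat s × Incl j × (f ≡ j ∘ s))))

-- Given f ∘ s ≡ f ∘ s', the pair (f ∘ s , f ∘ s') factors through the minimal
-- pullback square completing the span (f , f), and both s and s' are
-- factorisations; uniqueness gives s ≡ s'. For joint epicity, f ∘ x , f ∘ x'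
-- is again a pullback over u , u' because f is mono, so minimality yields a
-- unique comparison map W̄ → w₁, and both f and g are comparison maps.
module Submission where

open import Defs
open import Level using (Level)
open import Relation.Binary.PropositionalEquality
  using (_≡_; refl; sym; trans; cong; module ≡-Reasoning)
open import Data.Product using (_×_; _,_)

module _ {o ℓ : Level} (C : Category o ℓ) where
  open Category C
  open ≡-Reasoning

  ∃!-unique : ∀ {a p} {A : Set a} {P : A → Set p} → ∃! C P →
              ∀ {t t'} → P t → P t' → t ≡ t'
  ∃!-unique (_ , _ , uniq) {t} {t'} Pt Pt' = trans (uniq t Pt) (sym (uniq t' Pt'))

  ∘-assoc-square : ∀ {a b c d e} {f : Hom d e} {g : Hom c d} {h : Hom b d}
                   {k : Hom a c} {l : Hom a b} →
                   f ∘ g ∘ k ≡ f ∘ h ∘ l → (f ∘ g) ∘ k ≡ (f ∘ h) ∘ l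
  ∘-assoc-square {f = f} {g} {h} {k} {l} eq = begin
    (f ∘ g) ∘ k  ≡⟨ assoc f g k ⟩
    f ∘ g ∘ k    ≡⟨ eq ⟩
    f ∘ h ∘ l    ≡⟨ sym (assoc f h l) ⟩
    (f ∘ h) ∘ l  ∎

  IsPullback-over-f-f⇒Mono : ∀ {a b W̄} {f : Hom a b} {x x' : Hom b W̄} →
                              IsPullback C x x' f f → Mono C f
  IsPullback-over-f-f⇒Mono {f = f} {x} {x'} (square , universal) s s' fs≡fs' =
    ∃!-unique (universal (f ∘ s) (f ∘ s') comm) (refl , sym fs≡fs') (fs≡fs' , refl)
    where
    comm : x ∘ f ∘ s ≡ x' ∘ f ∘ s'
    comm = begin
      x ∘ f ∘ s     ≡⟨ sym (assoc x f s) ⟩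
      (x ∘ f) ∘ s   ≡⟨ cong (_∘ s) square ⟩
      (x' ∘ f) ∘ s  ≡⟨ assoc x' f s ⟩
      x' ∘ f ∘ s    ≡⟨ cong (x' ∘_) fs≡fs' ⟩
      x' ∘ f ∘ s'   ∎

  Mono∘-preserves-IsPullback : ∀ {w w' W̄ w̲ w₁} {x : Hom w W̄} {x' : Hom w' W̄}
                               {u : Hom w̲ w} {u' : Hom w̲ w'} {f : Hom W̄ w₁} →
                               Mono C f → IsPullback C x x' u u' →
                               IsPullback C (f ∘ x) (f ∘ x') u u'
  Mono∘-preserves-IsPullback {x = x} {x'} {f = f} mono (square , universal) =
    ∘-assoc-square (cong (f ∘_) square) ,
    λ v v' fxv≡fx'v' → universal v v'
      (mono (x ∘ v) (x' ∘ v') (trans (sym (assoc f x v)) (trans fxv≡fx'v' (assoc f x' v'))))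

  IsMinimalPullback-jointlyEpic-onMono :
    ∀ {w w' W̄ w̲ w₁} {x : Hom w W̄} {x' : Hom w' W̄} {u : Hom w̲ w} {u' : Hom w̲ w'} →
    IsMinimalPullback C x x' u u' → (f g : Hom W̄ w₁) → Mono C f →
    f ∘ x ≡ g ∘ x → f ∘ x' ≡ g ∘ x' → f ≡ g
  IsMinimalPullback-jointlyEpic-onMono (pullback , minimal) f g mono fx≡gx fx'≡gx' =
    ∃!-unique (minimal _ _ (Mono∘-preserves-IsPullback mono pullback))
      (refl , refl) (fx≡gx , fx'≡gx')

proposition3p2 : ∀ {o ℓ i : Level} (W : CategoryOfWorlds o ℓ i) →
    let C = CategoryOfWorlds.cat W in
    let open Category C in
    (∀ {a b} (f : Hom a b) → Mono C f) ×
    (∀ {w w' W̄ w̲} (x : Hom w W̄) (x' : Hom w' W̄) (u : Hom w̲ w) (u' : Hom w̲ w') →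
       IsMinimalPullback C x x' u u' →
       ∀ {w₁} (f g : Hom W̄ w₁) → f ∘ x ≡ g ∘ x → f ∘ x' ≡ g ∘ x' → f ≡ g)
proposition3p2 W = allMono , λ x x' u u' minimal f g →
    IsMinimalPullback-jointlyEpic-onMono cat minimal f g (allMono f)
  where
  open CategoryOfWorlds W using (cat; minimalPullbacks)
  open Category cat using (Hom)

  allMono : ∀ {a b} (f : Hom a b) → Mono cat f
  allMono f with minimalPullbacks f f
  ... | _ , _ , _ , pullback , _ = IsPullback-over-f-f⇒Mono cat pullback
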